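{- Let $\mathcal{S}$ be a class of relational structures over a fixed finite dictionary $\sigma$. If $\mathcal{S}$ has bounded expansion (is nowhere dense), then the class $\mathcal{S}^i=\{G^i_S : S\in\mathcal{S}\}$ of incidence graphs has bounded expansion (is nowhere dense, respectively).
   Context: A dictionary $\sigma$ is a finite set of relation symbols with finite arities. A relational structure $S$ over $\sigma$ consists of a universe $V(S)$ and, for each $R\in\sigma$ of arity $r$, a set $R^S\subseteq V(S)^r$. The Gaifman graph $G_S$ has vertex set $V(S)$ and an edge between distinct $a,b$ if some tuple in some $R^S$ contains both $a$ and $b$. The incidence graph $G^i_S$ is the bipartite graph with edges colored by $\sigma\cup\{c\}$ ($c\notin\sigma$) whose vertex set consists of $V(S)$ together with two vertices $v_{R,x_1,\ldots,x_k}$ and $v'_{R,x_1,\ldots,x_k}$ for each $k$-ary $R\in\sigma$ and each $(x_1,\ldots,x_k)\in R^S$; for each such pair it contains the edge $v_{R,x_1,\ldots,x_k}v'_{R,x_1,\ldots,x_k}$ colored $R$ and the edges $x_jv_{R,x_1,\ldots,x_k}$ ($1\le j\le k$) colored $c$. A class of structures has bounded expansion (is nowhere dense) if the class of their Gaifman graphs does. For graphs: a minor of depth $r$ is obtained from a subgraph by contracting vertex-disjoint subgraphs of radius at most $r$; $\nabla_r(G)$ is the maximum edge/vertex ratio of such minors; a class has bounded expansion if there is $f$ with $\nabla_r(G)\le f(r)$ for all members $G$ and all $r$; a class is nowhere dense if there is $f$ such that every depth-$r$ minor of every member has clique number at most $f(r)$. (Edge colors are ignored for these notions.) -}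

module Defs where

open import Data.Nat using (ℕ; zero; suc; _*_; _≤_)
open import Data.Nat.Base using (_<ᵇ_)
open import Data.Fin using (Fin; toℕ)
open import Data.Bool using (Bool; true; false; T; _∧_; if_then_else_)
open import Data.List using (List; map; allFin)
open import Data.Nat.ListAction using (sum)
open import Data.Vec using (Vec)
open import Data.Vec.Membership.Propositional using (_∈_)
open import Data.Product using (Σ; _×_; ∃; ∃-syntax)
open import Data.Sum using (_⊎_; inj₁; inj₂)
open import Relation.Binary.PropositionalEquality using (_≡_; _≢_)
open import Function.Definitions using (Injective)

record Dictionary : Set where
  field
    k  : ℕ
    ar : Fin k → ℕ
open Dictionary public

record Structure (σ : Dictionary) : Set where
  field
    n   : ℕ
    rel : (R : Fin (k σ)) → Vec (Fin n) (ar σ R) → Bool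
open Structure public

record Graph : Set₁ where
  field
    V : Set
    E : V → V → Set
open Graph public

record FinGraph : Set where
  field
    m      : ℕ
    adj    : Fin m → Fin m → Bool
    sym    : ∀ i j → adj i j ≡ adj j i
    irrefl : ∀ i → adj i i ≡ false
open FinGraph public

edgeCount : FinGraph → ℕ
edgeCount H = sum (map (λ i → sum (map (λ j →
  if (toℕ i <ᵇ toℕ j) ∧ adj H i j then 1 else 0) (allFin (m H)))) (allFin (m H)))

data WithinB (G : Graph) (B : V G → Set) : ℕ → V G → V G → Set where
  here : ∀ {r v} → WithinB G B r v v
  step : ∀ {r u w v} → E G u w → B w → WithinB G B r w v → WithinB G B (suc r) u v

RadiusAtMost : (G : Graph) → (V G → Set) → ℕ → Set
RadiusAtMost G B r = Σ (V G) λ c → B c × (∀ v → B v → WithinB G B r c v)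

-- H is a depth-r minor of G: branch sets (pairwise disjoint, each of radius ≤ r)
-- for the vertices of H, with an edge of G between the branch sets of adjacent vertices.
-- (This is the literal unfolding of "contract vertex-disjoint subgraphs of radius
-- ≤ r of a subgraph of G".)
record DepthMinor (r : ℕ) (H : FinGraph) (G : Graph) : Set₁ where
  field
    branch   : Fin (m H) → V G → Set
    disjoint : ∀ h h' v → branch h v → branch h' v → h ≡ h'
    radius   : ∀ h → RadiusAtMost G (branch h) r
    edges    : ∀ h h' → T (adj H h h') →
               Σ (V G) λ u → Σ (V G) λ v → branch h u × branch h' v × E G u v

GraphClass : Set₂
GraphClass = Graph → Set₁

-- ∇_r(G) ≤ f(r) for all G in the class: every depth-r minor H satisfies
-- |E(H)| ≤ f(r)·|V(H)|.
BoundedExpansion : GraphClass → Set₁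
BoundedExpansion 𝒞 = Σ (ℕ → ℕ) λ f → ∀ G → 𝒞 G → ∀ r (H : FinGraph) →
  DepthMinor r H G → edgeCount H ≤ f r * m H

Clique : FinGraph → ℕ → Set
Clique H t = Σ (Fin t → Fin (m H)) λ φ → Injective _≡_ _≡_ φ ×
  (∀ i j → i ≢ j → T (adj H (φ i) (φ j)))

NowhereDense : GraphClass → Set₁
NowhereDense 𝒞 = Σ (ℕ → ℕ) λ f → ∀ G → 𝒞 G → ∀ r (H : FinGraph) →
  DepthMinor r H G → ∀ t → Clique H t → t ≤ f r

Gaifman : {σ : Dictionary} → Structure σ → Graph
Gaifman {σ} S = record
  { V = Fin (n S)
  ; E = λ a b → a ≢ b × (Σ (Fin (k σ)) λ R → Σ (Vec (Fin (n S)) (ar σ R)) λ t →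
                   T (rel S R t) × a ∈ t × b ∈ t) }

Tuple : {σ : Dictionary} → Structure σ → Set
Tuple {σ} S = Σ (Fin (k σ)) λ R → Σ (Vec (Fin (n S)) (ar σ R)) λ t → T (rel S R t)

tupleVec : {σ : Dictionary} {S : Structure σ} (e : Tuple S) →
           Vec (Fin (n S)) (ar σ (Data.Product.proj₁ e))
tupleVec e = Data.Product.proj₁ (Data.Product.proj₂ e)

-- vertices: universe elements, v_{R,x̄} (tuple vertex, false) and v'_{R,x̄} (true)
IncVertex : {σ : Dictionary} → Structure σ → Set
IncVertex S = Fin (n S) ⊎ (Tuple S × Bool)

-- the (directed) generating edges; colours are ignored
data IncBase {σ : Dictionary} (S : Structure σ) : IncVertex S → IncVertex S → Set where
  colR : (e : Tuple S) → IncBase S (inj₂ (e Data.Product., false)) (inj₂ (e Data.Product., true))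
  colc : (e : Tuple S) (x : Fin (n S)) → x ∈ tupleVec {S = S} e →
         IncBase S (inj₁ x) (inj₂ (e Data.Product., false))

Incidence : {σ : Dictionary} → Structure σ → Graph
Incidence S = record { V = IncVertex S ; E = λ a b → IncBase S a b ⊎ IncBase S b a }

StructureClass : Dictionary → Set₁
StructureClass σ = Structure σ → Set

GaifmanClass : {σ : Dictionary} → StructureClass σ → GraphClass
GaifmanClass {σ} 𝒮 G = Σ (Structure σ) λ S → 𝒮 S × (G ≡ Gaifman S)

IncidenceClass : {σ : Dictionary} → StructureClass σ → GraphClass
IncidenceClass {σ} 𝒮 G = Σ (Structure σ) λ S → 𝒮 S × (G ≡ Incidence S)

StructBoundedExpansion : {σ : Dictionary} → StructureClass σ → Set₁
StructBoundedExpansion 𝒮 = BoundedExpansion (GaifmanClass 𝒮)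

StructNowhereDense : {σ : Dictionary} → StructureClass σ → Set₁
StructNowhereDense 𝒮 = NowhereDense (GaifmanClass 𝒮)

-- Let H be a depth-r minor of the incidence graph.  If a branch set contains a universe
-- element, then its walks project to walks of no greater length between universe
-- elements of the same branch set in the Gaifman graph (a step through a tuple vertex v_e
-- becomes a Gaifman edge between two entries of e), and every tuple vertex in it is
-- joined inside it to an entry of its tuple; so these branch sets, cut down to the
-- universe, form a depth-r minor of the Gaifman graph.  Otherwise the branch set reaches
-- its neighbours only through v_e and v'_e for a single tuple e, so by disjointness that
-- vertex of H has degree at most ar(e) + 2 ≤ Δ := 2 + Σ_R ar(R).  Hence H has at most
-- 2Δ|V(H)| edges beyond those of a depth-r minor of the Gaifman graph, and a clique of H
-- with more than Δ + 1 vertices is a clique minor of the Gaifman graph.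
module Submission where

open import Defs renaming (sym to adj-sym)
open import Data.Bool using (Bool; true; false; T; _∧_; not; if_then_else_)
open import Data.Bool.Properties using (T?)
open import Data.Empty using (⊥; ⊥-elim)
open import Data.Fin using (Fin; zero; suc; toℕ; _≟_; punchIn; inject≤)
open import Data.Fin.Properties
  using (injective⇒≤; suc-injective; <-cmp; punchIn-injective; punchInᵢ≢i; inject≤-injective)
import Data.List as List using (map; tabulate)
open import Data.Nat using (ℕ; zero; suc; _+_; _*_; _≤_; z≤n; s≤s; _<ᵇ_)
open import Data.Nat.Properties
  using (+-0-commutativeMonoid; ≤-refl; ≤-reflexive; ≤-trans; +-mono-≤; +-monoˡ-≤; +-monoʳ-≤;
         *-monoʳ-≤; m≤m+n; m≤n+m; +-identityʳ; <⇒<ᵇ; module ≤-Reasoning)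
import Data.Nat.ListAction as List using (sum)
open import Algebra.Properties.CommutativeMonoid.Sum +-0-commutativeMonoid
  using (sum-syntax; sum-cong-≗; ∑-distrib-+; ∑-comm; sum-replicate-zero)
open import Data.Nat.Tactic.RingSolver using (solve-∀)
open import Data.Product using (Σ; ∃; _×_; _,_; proj₁; proj₂)
open import Data.Sum using (_⊎_; inj₁; inj₂; [_,_]′; swap)
open import Data.Unit using (tt)
open import Data.Vec using (Vec; lookup)
open import Data.Vec.Membership.Propositional using (_∈_)
open import Data.Vec.Relation.Unary.Any using (index)
open import Data.Vec.Relation.Unary.Any.Properties using (lookup-index)
open import Function using (_∘_; id)
open import Function.Definitions using (Injective)
open import Relation.Binary using (tri<; tri≈; tri>)
open import Relation.Binary.PropositionalEquality
open import Relation.Nullary using (yes; no; does)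
open import Relation.Nullary.Decidable using (dec-true; dec-false)

-- Finite sums and subsets of Fin n

𝟙 : Bool → ℕ
𝟙 b = if b then 1 else 0

∑-mono-≤ : ∀ {n} {f g : Fin n → ℕ} → (∀ i → f i ≤ g i) → ∑[ i < n ] f i ≤ ∑[ i < n ] g i
∑-mono-≤ {zero}  f≤g = z≤n
∑-mono-≤ {suc n} f≤g = +-mono-≤ (f≤g zero) (∑-mono-≤ (f≤g ∘ suc))

∑-≤-* : ∀ {n c} {f : Fin n → ℕ} → (∀ i → f i ≤ c) → ∑[ i < n ] f i ≤ n * c
∑-≤-* {zero}  f≤c = z≤n
∑-≤-* {suc n} f≤c = +-mono-≤ (f≤c zero) (∑-≤-* (f≤c ∘ suc))

≤-∑ : ∀ {n} (f : Fin n → ℕ) i → f i ≤ ∑[ j < n ] f j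
≤-∑ f zero    = m≤m+n _ _
≤-∑ f (suc i) = ≤-trans (≤-∑ (f ∘ suc) i) (m≤n+m _ _)

sum-map-tabulate : ∀ {A : Set} {n} (f : A → ℕ) (g : Fin n → A) →
                   List.sum (List.map f (List.tabulate g)) ≡ ∑[ i < n ] f (g i)
sum-map-tabulate {n = zero}  f g = refl
sum-map-tabulate {n = suc n} f g = cong (f (g zero) +_) (sum-map-tabulate f (g ∘ suc))

count : ∀ {n} → (Fin n → Bool) → ℕ
count {n} P = ∑[ i < n ] 𝟙 (P i)

select-suc : ∀ {n c} (b : Bool) → (Fin c → Fin n) → Fin (𝟙 b + c) → Fin (suc n)
select-suc true  s zero    = zero
select-suc true  s (suc i) = suc (s i)
select-suc false s i       = suc (s i)

select : ∀ {n} (P : Fin n → Bool) → Fin (count P) → Fin n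
select {suc n} P = select-suc (P zero) (select (P ∘ suc))

select-∈ : ∀ {n} (P : Fin n → Bool) i → T (P (select P i))
select-∈ {suc n} P i with P zero in eq
select-∈ {suc n} P zero    | true  = subst T (sym eq) tt
select-∈ {suc n} P (suc i) | true  = select-∈ (P ∘ suc) i
select-∈ {suc n} P i       | false = select-∈ (P ∘ suc) i

select-injective : ∀ {n} (P : Fin n → Bool) → Injective _≡_ _≡_ (select P)
select-injective {suc n} P {i} {j} eq with P zero
select-injective {suc n} P {zero}  {zero}  eq | true  = refl
select-injective {suc n} P {suc i} {suc j} eq | true  = cong suc (select-injective (P ∘ suc) (suc-injective eq))
select-injective {suc n} P {i}     {j}     eq | false = select-injective (P ∘ suc) (suc-injective eq)

∑-select : ∀ {n} (P : Fin n → Bool) (g : Fin n → ℕ) →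
           ∑[ i < count P ] g (select P i) ≡ ∑[ j < n ] (if P j then g j else 0)
∑-select {zero}  P g = refl
∑-select {suc n} P g with P zero
... | true  = cong (g zero +_) (∑-select (P ∘ suc) (g ∘ suc))
... | false = ∑-select (P ∘ suc) (g ∘ suc)

count≤ : ∀ {n K} (P : Fin n → Bool) (code : ∀ j → T (P j) → Fin K) →
         (∀ {j j'} p p' → code j p ≡ code j' p' → j ≡ j') → count P ≤ K
count≤ P code code-injective =
  injective⇒≤ {f = λ i → code (select P i) (select-∈ P i)}
              (λ eq → select-injective P (code-injective _ _ eq))

-- Counting edges

degree : (H : FinGraph) → Fin (m H) → ℕ
degree H i = count (adj H i)

arcCount : FinGraph → ℕ
arcCount H = ∑[ i < m H ] degree H i

module _ (H : FinGraph) where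

  private
    ascending : Fin (m H) → Fin (m H) → ℕ
    ascending i j = 𝟙 ((toℕ i <ᵇ toℕ j) ∧ adj H i j)

    ascendingSum : ℕ
    ascendingSum = ∑[ i < m H ] ∑[ j < m H ] ascending i j

    edgeCount≡ : edgeCount H ≡ ascendingSum
    edgeCount≡ = trans (sum-map-tabulate (λ i → List.sum (List.map (ascending i) (List.tabulate id))) id)
                       (sum-cong-≗ (λ i → sum-map-tabulate (ascending i) id))

    𝟙-∧ : ∀ {a} b → T a → 𝟙 (a ∧ b) ≡ 𝟙 b
    𝟙-∧ {true} b _ = refl

    𝟙-∧-≤ : ∀ a b → 𝟙 (a ∧ b) ≤ 𝟙 b
    𝟙-∧-≤ true  b = ≤-refl
    𝟙-∧-≤ false b = z≤n

    arc≤ascending : ∀ i j → 𝟙 (adj H i j) ≤ ascending i j + ascending j i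
    arc≤ascending i j with <-cmp i j
    ... | tri< i<j _ _ = ≤-trans (≤-reflexive (sym (𝟙-∧ _ (<⇒<ᵇ i<j)))) (m≤m+n _ _)
    ... | tri> _ _ j<i = ≤-trans (≤-reflexive (trans (cong 𝟙 (adj-sym H i j)) (sym (𝟙-∧ _ (<⇒<ᵇ j<i)))))
                                 (m≤n+m _ _)
    ... | tri≈ _ refl _ = ≤-trans (≤-reflexive (cong 𝟙 (irrefl H i))) z≤n

  edgeCount≤arcCount : edgeCount H ≤ arcCount H
  edgeCount≤arcCount = subst (_≤ arcCount H) (sym edgeCount≡)
    (∑-mono-≤ λ i → ∑-mono-≤ λ j → 𝟙-∧-≤ (toℕ i <ᵇ toℕ j) (adj H i j))

  arcCount≤2*edgeCount : arcCount H ≤ 2 * edgeCount H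
  arcCount≤2*edgeCount = begin
    arcCount H
      ≤⟨ ∑-mono-≤ (λ i → ∑-mono-≤ (arc≤ascending i)) ⟩
    ∑[ i < m H ] ∑[ j < m H ] (ascending i j + ascending j i)
      ≡⟨ sum-cong-≗ (λ i → ∑-distrib-+ (ascending i) (λ j → ascending j i)) ⟩
    ∑[ i < m H ] (∑[ j < m H ] ascending i j + ∑[ j < m H ] ascending j i)
      ≡⟨ ∑-distrib-+ (λ i → ∑[ j < m H ] ascending i j) (λ i → ∑[ j < m H ] ascending j i) ⟩
    ascendingSum + ∑[ i < m H ] ∑[ j < m H ] ascending j i
      ≡⟨ cong (ascendingSum +_) (∑-comm (λ i j → ascending j i)) ⟩
    ascendingSum + ascendingSum
      ≡⟨ cong (λ k → k + k) (sym edgeCount≡) ⟩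
    edgeCount H + edgeCount H
      ≡⟨ cong (edgeCount H +_) (sym (+-identityʳ (edgeCount H))) ⟩
    2 * edgeCount H
      ∎
    where open ≤-Reasoning

induced : (H : FinGraph) → (Fin (m H) → Bool) → FinGraph
induced H P = record
  { m      = count P
  ; adj    = λ i j → adj H (select P i) (select P j)
  ; sym    = λ i j → adj-sym H (select P i) (select P j)
  ; irrefl = λ i → irrefl H (select P i)
  }

module _ (H : FinGraph) (P : Fin (m H) → Bool) where

  private
    N = m H

    a inside leaving : Fin N → Fin N → ℕ
    a i j = 𝟙 (adj H i j)
    inside i j = if P i then (if P j then a i j else 0) else 0
    leaving i j = if P i then 0 else a i j

    ∑∑ : (Fin N → Fin N → ℕ) → ℕ
    ∑∑ x = ∑[ i < N ] ∑[ j < N ] x i j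

    ∑∑-distrib-+ : ∀ x y → ∑∑ (λ i j → x i j + y i j) ≡ ∑∑ x + ∑∑ y
    ∑∑-distrib-+ x y = trans (sum-cong-≗ (λ i → ∑-distrib-+ (x i) (y i)))
                             (∑-distrib-+ (λ i → ∑[ j < N ] x i j) (λ i → ∑[ j < N ] y i j))

    arc≤split : ∀ i j → a i j ≤ inside i j + (leaving i j + leaving j i)
    arc≤split i j with P i | P j
    ... | true  | true  = m≤m+n _ _
    ... | true  | false = ≤-reflexive (cong 𝟙 (adj-sym H i j))
    ... | false | _     = ≤-trans (m≤m+n (a i j) _) (m≤n+m _ 0)

  arcCount-induced : arcCount (induced H P) ≡ ∑∑ inside
  arcCount-induced = begin
    ∑[ i < count P ] ∑[ j < count P ] a (select P i) (select P j)
      ≡⟨ sum-cong-≗ (λ i → ∑-select P (a (select P i))) ⟩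
    ∑[ i < count P ] ∑[ j < N ] (if P j then a (select P i) j else 0)
      ≡⟨ ∑-select P (λ i → ∑[ j < N ] (if P j then a i j else 0)) ⟩
    ∑[ i < N ] (if P i then ∑[ j < N ] (if P j then a i j else 0) else 0)
      ≡⟨ sum-cong-≗ row ⟩
    ∑∑ inside
      ∎
    where
    open ≡-Reasoning
    row : ∀ i → (if P i then ∑[ j < N ] (if P j then a i j else 0) else 0) ≡ ∑[ j < N ] inside i j
    row i with P i
    ... | true  = refl
    ... | false = sym (sum-replicate-zero N)

  -- every arc not inside P leaves P at its tail or at its head
  arcCount≤induced : ∀ D → (∀ i → P i ≡ false → degree H i ≤ D) →
                     arcCount H ≤ arcCount (induced H P) + (N * D + N * D)
  arcCount≤induced D low-degree = begin
    arcCount H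
      ≤⟨ ∑-mono-≤ (λ i → ∑-mono-≤ (arc≤split i)) ⟩
    ∑∑ (λ i j → inside i j + (leaving i j + leaving j i))
      ≡⟨ ∑∑-distrib-+ inside _ ⟩
    ∑∑ inside + ∑∑ (λ i j → leaving i j + leaving j i)
      ≡⟨ cong₂ _+_ (sym arcCount-induced) (∑∑-distrib-+ leaving _) ⟩
    arcCount (induced H P) + (∑∑ leaving + ∑∑ (λ i j → leaving j i))
      ≡⟨ cong (λ k → arcCount (induced H P) + (∑∑ leaving + k)) (∑-comm (λ i j → leaving j i)) ⟩
    arcCount (induced H P) + (∑∑ leaving + ∑∑ leaving)
      ≤⟨ +-monoʳ-≤ (arcCount (induced H P)) (+-mono-≤ ∑∑leaving≤ ∑∑leaving≤) ⟩
    arcCount (induced H P) + (N * D + N * D)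
      ∎
    where
    open ≤-Reasoning
    row≤ : ∀ i → ∑[ j < N ] leaving i j ≤ D
    row≤ i with P i in eq
    ... | true  = ≤-trans (≤-reflexive (sum-replicate-zero N)) z≤n
    ... | false = low-degree i eq
    ∑∑leaving≤ : ∑∑ leaving ≤ N * D
    ∑∑leaving≤ = ∑-≤-* row≤

record NeighbourhoodCode (H : FinGraph) (i : Fin (m H)) (K : ℕ) : Set where
  field
    code           : ∀ j → T (adj H i j) → Fin K
    code-injective : ∀ {j j'} p p' → code j p ≡ code j' p' → j ≡ j'

degree≤ : ∀ {H i K} → NeighbourhoodCode H i K → degree H i ≤ K
degree≤ {H} {i} c = count≤ (adj H i) code code-injective
  where open NeighbourhoodCode c

clique≤ : ∀ {H t K} (C : Clique H t) (k : Fin t) → NeighbourhoodCode H (proj₁ C k) K → t ≤ suc K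
clique≤ {H} {suc t} {K} (φ , φ-injective , φ-adj) k c =
  s≤s (injective⇒≤ {f = code'} λ eq →
    punchIn-injective k _ _ (φ-injective (code-injective (neighbour _) (neighbour _) eq)))
  where
  open NeighbourhoodCode c
  neighbour : ∀ j → T (adj H (φ k) (φ (punchIn k j)))
  neighbour j = φ-adj k (punchIn k j) (punchInᵢ≢i k j ∘ sym)
  code' : Fin t → Fin K
  code' j = code _ (neighbour j)

complete : ℕ → FinGraph
complete t = record
  { m      = t
  ; adj    = λ i j → not (does (i ≟ j))
  ; sym    = symmetric
  ; irrefl = λ i → cong not (dec-true (i ≟ i) refl)
  }
  where
  symmetric : ∀ (i j : Fin t) → not (does (i ≟ j)) ≡ not (does (j ≟ i))
  symmetric i j with i ≟ j
  ... | yes refl = cong not (sym (dec-true (i ≟ i) refl))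
  ... | no i≢j   = cong not (sym (dec-false (j ≟ i) (i≢j ∘ sym)))

adjacent-distinct : ∀ {H : FinGraph} {i j} → T (adj H i j) → i ≢ j
adjacent-distinct {H} {i} p refl = subst T (irrefl H i) p

complete-adj : ∀ {t} {i j : Fin t} → T (adj (complete t) i j) → i ≢ j
complete-adj {i = i} p refl = subst (T ∘ not) (dec-true (i ≟ i) refl) p

complete-clique : ∀ t → Clique (complete t) t
complete-clique t = id , id , λ i j i≢j → subst (T ∘ not) (sym (dec-false (i ≟ j) i≢j)) tt

allOrSome : ∀ {n} {A B : Fin n → Set} → (∀ i → A i ⊎ B i) → (∀ i → A i) ⊎ ∃ B
allOrSome {zero}  d = inj₁ λ ()
allOrSome {suc n} d with d zero | allOrSome (d ∘ suc)
... | inj₂ b | _            = inj₂ (zero , b)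
... | inj₁ _ | inj₂ (i , b) = inj₂ (suc i , b)
... | inj₁ a | inj₁ as      = inj₁ λ { zero → a ; (suc i) → as i }

WithinB-suc : ∀ {G B r u v} → WithinB G B r u v → WithinB G B (suc r) u v
WithinB-suc here            = here
WithinB-suc (step e b walk) = step e b (WithinB-suc walk)

-- The incidence graph

nbhdBound : Dictionary → ℕ
nbhdBound σ = suc (suc (∑[ R < k σ ] ar σ R))

module IncidenceGraph {σ : Dictionary} (S : Structure σ) where

  private
    U = Fin (n S)
    I = Incidence S
    G = Gaifman S
    Branch = IncVertex S → Set

  entries : (e : Tuple S) → Vec U (ar σ (proj₁ e))
  entries e = tupleVec {S = S} e

  InPair : Tuple S → IncVertex S → Set
  InPair e (inj₁ _)        = ⊥
  InPair e (inj₂ (e' , _)) = e' ≡ e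

  InStar : Tuple S → IncVertex S → Set
  InStar e (inj₁ x)        = x ∈ entries e
  InStar e (inj₂ (e' , _)) = e' ≡ e

  -- a walk from a projects to a Gaifman walk from x₀
  Near : U → IncVertex S → Set
  Near x₀ (inj₁ x)       = x ≡ x₀
  Near x₀ (inj₂ (e , _)) = x₀ ∈ entries e

  Meets : Branch → Tuple S → Set
  Meets B e = Σ U λ y → y ∈ entries e × B (inj₁ y)

  starVertex : (e : Tuple S) → Fin (suc (suc (ar σ (proj₁ e)))) → IncVertex S
  starVertex e zero          = inj₂ (e , false)
  starVertex e (suc zero)    = inj₂ (e , true)
  starVertex e (suc (suc i)) = inj₁ (lookup (entries e) i)

  starVertex-surjective : ∀ {e v} → InStar e v → Σ _ λ k → starVertex e k ≡ v
  starVertex-surjective {v = inj₁ x}           x∈e  =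
    suc (suc (index x∈e)) , cong inj₁ (sym (lookup-index x∈e))
  starVertex-surjective {v = inj₂ (e , false)} refl = zero , refl
  starVertex-surjective {v = inj₂ (e , true)}  refl = suc zero , refl

  edge-star : ∀ {u v} → E I u v → Σ (Tuple S) λ e → InStar e u × InStar e v
  edge-star (inj₁ (colR e))       = e , refl , refl
  edge-star (inj₁ (colc e x x∈e)) = e , x∈e , refl
  edge-star (inj₂ (colR e))       = e , refl , refl
  edge-star (inj₂ (colc e x x∈e)) = e , refl , x∈e

  pair-edge-star : ∀ {e u v} → InPair e u → E I u v → InStar e v
  pair-edge-star refl (inj₁ (colR _))       = refl
  pair-edge-star refl (inj₂ (colR _))       = refl
  pair-edge-star refl (inj₂ (colc _ _ x∈e)) = x∈e

  star-pair-or-meets : ∀ {B e v} → InStar e v → B v → InPair e v ⊎ Meets B e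
  star-pair-or-meets {v = inj₁ x} x∈e Bx = inj₂ (x , x∈e , Bx)
  star-pair-or-meets {v = inj₂ _} refl _ = inj₁ refl

  -- a walk that leaves the pair {v_e, v'_e} does so through an entry of e

  walk-to-pair : ∀ {B L a v e} → WithinB I B L a v → B a → InPair e v → InPair e a ⊎ Meets B e
  walk-to-pair here                  Ba v∈e = inj₁ v∈e
  walk-to-pair {B} (step uw Bw walk) Ba v∈e with walk-to-pair walk Bw v∈e
  ... | inj₁ w∈e   = star-pair-or-meets {B} (pair-edge-star w∈e (swap uw)) Ba
  ... | inj₂ meets = inj₂ meets

  walk-from-pair : ∀ {B L a u e} → WithinB I B L a u → InPair e a → InPair e u ⊎ Meets B e
  walk-from-pair here                  a∈e = inj₁ a∈e
  walk-from-pair {B} (step aw Bw walk) a∈e with star-pair-or-meets {B} (pair-edge-star a∈e aw) Bw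
  ... | inj₁ w∈e   = walk-from-pair walk w∈e
  ... | inj₂ meets = inj₂ meets

  project-walk : ∀ {B L a y x₀} → WithinB I B L a (inj₁ y) → Near x₀ a →
                 WithinB G (B ∘ inj₁) L x₀ y
  project-walk here refl = here
  project-walk (step (inj₁ (colR _))       _ walk) near = WithinB-suc (project-walk walk near)
  project-walk (step (inj₂ (colR _))       _ walk) near = WithinB-suc (project-walk walk near)
  project-walk (step (inj₁ (colc _ _ x∈e)) _ walk) refl = WithinB-suc (project-walk walk x∈e)
  project-walk {x₀ = x₀} (step (inj₂ (colc (R , t , Rt) x x∈e)) Bx walk) x₀∈e with x₀ ≟ x
  ... | yes refl = WithinB-suc (project-walk walk refl)
  ... | no x₀≢x  = step (x₀≢x , R , t , Rt , x₀∈e , x∈e) Bx (project-walk walk refl)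

  Anchored : Branch → Set
  Anchored B = ∀ e b → B (inj₂ (e , b)) → Meets B e

  anchored-meets : ∀ {B e w} → Anchored B → B w → InStar e w → Meets B e
  anchored-meets {w = inj₁ x}       _        Bx x∈e  = x , x∈e , Bx
  anchored-meets {w = inj₂ (e , b)} anchored Bw refl = anchored e b Bw

  GaifmanBranch : ℕ → Branch → Set
  GaifmanBranch r B = RadiusAtMost G (B ∘ inj₁) r × Anchored B

  gaifmanBranch : ∀ {B r c} x₀ → B c → (∀ v → B v → WithinB I B r c v) →
                  B (inj₁ x₀) → Near x₀ c → (∀ e → InPair e c → Meets B e) → GaifmanBranch r B
  gaifmanBranch x₀ Bc walk Bx₀ near c-meets =
      (x₀ , Bx₀ , λ y By → project-walk (walk (inj₁ y) By) near)
    , λ e b Bv → [ c-meets e , id ]′ (walk-to-pair (walk _ Bv) Bc refl)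

  module _ {r : ℕ} {H : FinGraph} (M : DepthMinor r H I) where
    open DepthMinor M

    private
      Coded : Fin (m H) → Tuple S → Fin (m H) → Set
      Coded h e h' = T (adj H h h') → Σ _ λ k → branch h' (starVertex e k)

      arity≤ : (e : Tuple S) → suc (suc (ar σ (proj₁ e))) ≤ nbhdBound σ
      arity≤ (R , _) = s≤s (s≤s (≤-∑ (ar σ) R))

    -- disjoint branch sets meet the star of e in distinct vertices
    starCode : ∀ {h} e → (∀ h' → Coded h e h') → NeighbourhoodCode H h (nbhdBound σ)
    starCode e coded = record
      { code           = λ h' p → inject≤ (proj₁ (coded h' p)) (arity≤ e)
      ; code-injective = λ p p' eq → same-vertex p p' (inject≤-injective _ _ _ _ eq)
      }
      where
      same-vertex : ∀ {j j'} p p' → proj₁ (coded j p) ≡ proj₁ (coded j' p') → j ≡ j'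
      same-vertex {j} {j'} p p' eq = disjoint j j' _ (proj₂ (coded j p))
        (subst (λ k → branch j' (starVertex e k)) (sym eq) (proj₂ (coded j' p')))

    coded-or-meets : ∀ {h e b} → (∀ v → branch h v → WithinB I (branch h) r (inj₂ (e , b)) v) →
                     ∀ h' → Coded h e h' ⊎ Meets (branch h) e
    coded-or-meets {h} walk h' with T? (adj H h h')
    ... | no ¬p = inj₁ (⊥-elim ∘ ¬p)
    ... | yes p with edges h h' p
    ... | u , v , Bu , Bv , uv with walk-from-pair (walk u Bu) refl
    ... | inj₂ meets = inj₂ meets
    ... | inj₁ u∈e with starVertex-surjective (pair-edge-star u∈e uv)
    ... | k , refl = inj₁ λ _ → k , Bv

    classify : ∀ h → GaifmanBranch r (branch h) ⊎ NeighbourhoodCode H h (nbhdBound σ)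
    classify h with radius h
    ... | inj₁ x₀ , Bc , walk = inj₁ (gaifmanBranch x₀ Bc walk Bc refl λ _ ())
    ... | inj₂ (e , b) , Bc , walk with allOrSome (coded-or-meets walk)
    ...   | inj₁ coded              = inj₂ (starCode e coded)
    ...   | inj₂ (_ , y , y∈e , By) = inj₁ (gaifmanBranch y Bc walk By y∈e λ { _ refl → y , y∈e , By })

    gaifman-edge : ∀ {h h'} → GaifmanBranch r (branch h) → GaifmanBranch r (branch h') →
                   T (adj H h h') → Σ U λ x → Σ U λ y → branch h (inj₁ x) × branch h' (inj₁ y) × E G x y
    gaifman-edge {h} {h'} (_ , anchored) (_ , anchored') p with edges h h' p
    ... | u , v , Bu , Bv , uv with edge-star uv
    ... | (R , t , Rt) , u∈e , v∈e
        with anchored-meets {branch h} anchored Bu u∈e | anchored-meets {branch h'} anchored' Bv v∈e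
    ... | x , x∈e , Bx | y , y∈e , By = x , y , Bx , By , x≢y , R , t , Rt , x∈e , y∈e
      where
      x≢y : x ≢ y
      x≢y refl = adjacent-distinct {H} p (disjoint h h' _ Bx By)

    gaifmanMinor : (J : FinGraph) (ψ : Fin (m J) → Fin (m H)) → Injective _≡_ _≡_ ψ →
                   (∀ i → GaifmanBranch r (branch (ψ i))) →
                   (∀ i j → T (adj J i j) → T (adj H (ψ i) (ψ j))) → DepthMinor r J G
    gaifmanMinor J ψ ψ-injective ψ-gaifman ψ-adj = record
      { branch   = λ i x → branch (ψ i) (inj₁ x)
      ; disjoint = λ i j x Bi Bj → ψ-injective (disjoint (ψ i) (ψ j) (inj₁ x) Bi Bj)
      ; radius   = λ i → proj₁ (ψ-gaifman i)
      ; edges    = λ i j p → gaifman-edge (ψ-gaifman i) (ψ-gaifman j) (ψ-adj i j p)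
      }

    isGaifmanBranch : Fin (m H) → Bool
    isGaifmanBranch h with classify h
    ... | inj₁ _ = true
    ... | inj₂ _ = false

    isGaifmanBranch-true : ∀ h → T (isGaifmanBranch h) → GaifmanBranch r (branch h)
    isGaifmanBranch-true h p with classify h
    ... | inj₁ g = g

    isGaifmanBranch-false : ∀ h → isGaifmanBranch h ≡ false → NeighbourhoodCode H h (nbhdBound σ)
    isGaifmanBranch-false h eq with classify h
    ... | inj₂ c = c

-- Transfer of the bounds

EdgeBound : (ℕ → ℕ) → Graph → Set₁
EdgeBound f G = ∀ r (H : FinGraph) → DepthMinor r H G → edgeCount H ≤ f r * m H

CliqueBound : (ℕ → ℕ) → Graph → Set₁
CliqueBound f G = ∀ r (H : FinGraph) → DepthMinor r H G → ∀ t → Clique H t → t ≤ f r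

module _ {σ : Dictionary} {S : Structure σ} where
  open IncidenceGraph S

  private
    Δ = nbhdBound σ

    rearrange : ∀ a d N → 2 * (a * N) + (N * d + N * d) ≡ (2 * a + 2 * d) * N
    rearrange = solve-∀

  incidence-edgeBound : ∀ {f} → EdgeBound f (Gaifman S) →
                        EdgeBound (λ r → 2 * f r + 2 * Δ) (Incidence S)
  incidence-edgeBound {f} bound r H M = begin
    edgeCount H
      ≤⟨ edgeCount≤arcCount H ⟩
    arcCount H
      ≤⟨ arcCount≤induced H P Δ (λ h → degree≤ ∘ isGaifmanBranch-false M h) ⟩
    arcCount H[P] + (N * Δ + N * Δ)
      ≤⟨ +-monoˡ-≤ _ (arcCount≤2*edgeCount H[P]) ⟩
    2 * edgeCount H[P] + (N * Δ + N * Δ)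
      ≤⟨ +-monoˡ-≤ _ (*-monoʳ-≤ 2 (bound r H[P] H[P]-minor)) ⟩
    2 * (f r * count P) + (N * Δ + N * Δ)
      ≤⟨ +-monoˡ-≤ _ (*-monoʳ-≤ 2 (*-monoʳ-≤ (f r) (count≤ P (λ j _ → j) (λ _ _ → id)))) ⟩
    2 * (f r * N) + (N * Δ + N * Δ)
      ≡⟨ rearrange (f r) Δ N ⟩
    (2 * f r + 2 * Δ) * N
      ∎
    where
    open ≤-Reasoning
    N = m H
    P = isGaifmanBranch M
    H[P] = induced H P
    H[P]-minor : DepthMinor r H[P] (Gaifman S)
    H[P]-minor = gaifmanMinor M H[P] (select P) (select-injective P)
                   (λ i → isGaifmanBranch-true M _ (select-∈ P i)) (λ _ _ p → p)

  incidence-cliqueBound : ∀ {f} → CliqueBound f (Gaifman S) →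
                          CliqueBound (λ r → f r + suc Δ) (Incidence S)
  incidence-cliqueBound {f} bound r H M t C@(φ , φ-injective , φ-adj) with allOrSome (classify M ∘ φ)
  ... | inj₁ gaifman = ≤-trans (bound r (complete t) Kₜ-minor t (complete-clique t)) (m≤m+n (f r) _)
    where
    Kₜ-minor : DepthMinor r (complete t) (Gaifman S)
    Kₜ-minor = gaifmanMinor M (complete t) φ φ-injective gaifman (λ i j → φ-adj i j ∘ complete-adj)
  ... | inj₂ (k , coded) = ≤-trans (clique≤ C k coded) (m≤n+m _ (f r))

lemma15 : (σ : Dictionary) (𝒮 : StructureClass σ) →
          (StructBoundedExpansion 𝒮 → BoundedExpansion (IncidenceClass 𝒮)) ×
          (StructNowhereDense 𝒮 → NowhereDense (IncidenceClass 𝒮))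
lemma15 σ 𝒮 = transfer-edges , transfer-cliques
  where
  transfer-edges : StructBoundedExpansion 𝒮 → BoundedExpansion (IncidenceClass 𝒮)
  transfer-edges (f , bound) = (λ r → 2 * f r + 2 * nbhdBound σ) ,
    λ { _ (S , S∈𝒮 , refl) → incidence-edgeBound {f = f} (bound _ (S , S∈𝒮 , refl)) }

  transfer-cliques : StructNowhereDense 𝒮 → NowhereDense (IncidenceClass 𝒮)
  transfer-cliques (f , bound) = (λ r → f r + suc (nbhdBound σ)) ,
    λ { _ (S , S∈𝒮 , refl) → incidence-cliqueBound {f = f} (bound _ (S , S∈𝒮 , refl)) }
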